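{- The statement "every continuous predicate on $[0,1]$ is uniformly continuous" is equivalent to Brouwer's full fan theorem.
   Context: Work in Bishop-style constructive mathematics (intuitionistic logic, CZF with dependent choice), where the fan theorem is not assumed. Let $2^{\mathbf{N}}$ be the set of infinite binary sequences, $2^*$ the set of finite binary sequences, and $\overline{\alpha}(N)$ the finite sequence of the first $N$ terms of $\alpha$. A set $B\subseteq2^*$ is a bar if for each $\alpha\in2^{\mathbf{N}}$ there exists $N$ with $\overline{\alpha}(N)\in B$; it is uniform if there exists $N$ such that for each $\alpha$ there is $n\leqslant N$ with $\overline{\alpha}(n)\in B$. The full fan theorem FT states: every bar is uniform. For $S\subseteq\mathbf{R}$, a predicate $P$ on $S\times\mathbf{R}^+\times\mathbf{R}^+$ is a continuous predicate on $S$ if (i) for each $x\in S$ and $\varepsilon>0$ there exists $\delta>0$ with $P(x,\varepsilon,\delta)$; and (ii) if $P(x,\varepsilon,\delta)$ and $|x-y|<\delta'<\delta$ (with $y\in S$), then $P(y,\varepsilon,\delta-\delta')$. It is a uniformly continuous predicate on $S$ if in addition for each $\varepsilon>0$ there exists $\delta>0$ such that $P(x,\varepsilon,\delta)$ for all $x\in S$. -}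

module Defs where

open import Data.Nat as ℕ using (ℕ; _⊔_)
open import Data.Nat.Properties as ℕP using (m≤m⊔n; m≤n⊔m)
open import Data.Rational as ℚ using (ℚ; 0ℚ; 1ℚ; ½; ∣_∣)
open import Data.Rational.Properties as ℚP
open import Algebra.Bundles using (CommutativeMonoid)
import Algebra.Properties.CommutativeSemigroup as CSProps
open import Data.Product using (Σ; _×_; _,_; proj₁; proj₂)
open import Data.Bool using (Bool)
open import Data.List using (List; map; upTo)
open import Relation.Nullary using (¬_)
open import Relation.Binary.PropositionalEquality
open import Level using () renaming (suc to lsuc; zero to lzero)

record ℝ : Set where
  constructor mkℝ
  field
    seq    : ℕ → ℚ
    cauchy : (ε : ℚ) → 0ℚ ℚ.< ε →
             Σ ℕ λ N → (m n : ℕ) → N ℕ.≤ m → N ℕ.≤ n →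
               ∣ ℚ._-_ (seq m) (seq n) ∣ ℚ.< ε

open ℝ public

_<_ : ℝ → ℝ → Set
x < y = Σ ℚ λ ε → (0ℚ ℚ.< ε) × (Σ ℕ λ N → (n : ℕ) → N ℕ.≤ n →
          ℚ._+_ (seq x n) ε ℚ.≤ seq y n)

infix 4 _<_ _≤_ _≃_

_≤_ : ℝ → ℝ → Set
x ≤ y = ¬ (y < x)

_≃_ : ℝ → ℝ → Set
x ≃ y = (x ≤ y) × (y ≤ x)

private
  q-q≡0 : (q : ℚ) → ℚ._-_ q q ≡ 0ℚ
  q-q≡0 q = +-inverseʳ q

  ∣q-q∣ : (q : ℚ) → ∣ ℚ._-_ q q ∣ ≡ 0ℚ
  ∣q-q∣ q = cong ∣_∣ (q-q≡0 q)

fromℚ : ℚ → ℝ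
fromℚ q = mkℝ (λ _ → q) (λ ε 0<ε → 0 , λ m n _ _ → subst (ℚ._< ε) (sym (∣q-q∣ q)) 0<ε)

0ℝ 1ℝ : ℝ
0ℝ = fromℚ 0ℚ
1ℝ = fromℚ 1ℚ

-_ : ℝ → ℝ
- x = mkℝ (λ n → ℚ.- seq x n) c
  where
  eq : (a b : ℚ) → ∣ ℚ._-_ (ℚ.- a) (ℚ.- b) ∣ ≡ ∣ ℚ._-_ a b ∣
  eq a b = trans (cong ∣_∣ (sym (neg-distrib-+ a (ℚ.- b)))) (∣-p∣≡∣p∣ (ℚ._-_ a b))
  c : (ε : ℚ) → 0ℚ ℚ.< ε → Σ ℕ λ N → (m n : ℕ) → N ℕ.≤ m → N ℕ.≤ n →
        ∣ ℚ._-_ (ℚ.- seq x m) (ℚ.- seq x n) ∣ ℚ.< ε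
  c ε 0<ε with cauchy x ε 0<ε
  ... | N , h = N , λ m n p q → subst (ℚ._< ε) (sym (eq (seq x m) (seq x n))) (h m n p q)

_+_ : ℝ → ℝ → ℝ
x + y = mkℝ (λ n → ℚ._+_ (seq x n) (seq y n)) c
  where
  open CSProps (CommutativeMonoid.commutativeSemigroup +-0-commutativeMonoid) using (interchange)
  rearr : (a b c d : ℚ) → ℚ._-_ (ℚ._+_ a b) (ℚ._+_ c d) ≡ ℚ._+_ (ℚ._-_ a c) (ℚ._-_ b d)
  rearr a b c d = trans (cong (ℚ._+_ (ℚ._+_ a b)) (neg-distrib-+ c d)) (interchange a b (ℚ.- c) (ℚ.- d))
  half : (ε : ℚ) → ℚ._+_ (ℚ._*_ ε ½) (ℚ._*_ ε ½) ≡ ε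
  half ε = trans (sym (*-distribˡ-+ ε ½ ½)) (*-identityʳ ε)
  c : (ε : ℚ) → 0ℚ ℚ.< ε → Σ ℕ λ N → (m n : ℕ) → N ℕ.≤ m → N ℕ.≤ n →
        ∣ ℚ._-_ (ℚ._+_ (seq x m) (seq y m)) (ℚ._+_ (seq x n) (seq y n)) ∣ ℚ.< ε
  c ε 0<ε with cauchy x (ℚ._*_ ε ½) (subst (ℚ._< ℚ._*_ ε ½) (*-zeroˡ ½) (*-monoˡ-<-pos ½ 0<ε))
             | cauchy y (ℚ._*_ ε ½) (subst (ℚ._< ℚ._*_ ε ½) (*-zeroˡ ½) (*-monoˡ-<-pos ½ 0<ε))
  ... | Nx , hx | Ny , hy = Nx ⊔ Ny , λ m n p q →
    let a = seq x m ; b = seq y m ; c' = seq x n ; d = seq y n in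
    subst (ℚ._< ε) (sym (cong ∣_∣ (rearr a b c' d)))
      (≤-<-trans (∣p+q∣≤∣p∣+∣q∣ (ℚ._-_ a c') (ℚ._-_ b d))
        (subst (ℚ._+_ ∣ ℚ._-_ a c' ∣ ∣ ℚ._-_ b d ∣ ℚ.<_) (half ε)
          (+-mono-< (hx m n (ℕP.≤-trans (m≤m⊔n Nx Ny) p) (ℕP.≤-trans (m≤m⊔n Nx Ny) q))
                    (hy m n (ℕP.≤-trans (m≤n⊔m Nx Ny) p) (ℕP.≤-trans (m≤n⊔m Nx Ny) q)))))

infixl 6 _+_ _-_
infix 8 -_

_-_ : ℝ → ℝ → ℝ
x - y = x + (- y)

∣_∣<_ : ℝ → ℝ → Set
∣ z ∣< d = (z < d) × ((- z) < d)

_∈[0,1] : ℝ → Set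
x ∈[0,1] = (0ℝ ≤ x) × (x ≤ 1ℝ)

-- Predicates on S × ℝ⁺ × ℝ⁺ (as predicates on sets, they respect equality).
Extensional : (ℝ → ℝ → ℝ → Set) → Set
Extensional P = (x x' ε ε' δ δ' : ℝ) → x ≃ x' → ε ≃ ε' → δ ≃ δ' → P x ε δ → P x' ε' δ'

record ContinuousPredicate (P : ℝ → ℝ → ℝ → Set) : Set where
  field
    extensional : Extensional P
    pointwise   : (x : ℝ) → x ∈[0,1] → (ε : ℝ) → 0ℝ < ε →
                  Σ ℝ λ δ → (0ℝ < δ) × P x ε δ
    shift       : (x y ε δ δ' : ℝ) → x ∈[0,1] → y ∈[0,1] → 0ℝ < ε → 0ℝ < δ →
                  P x ε δ → ∣ x - y ∣< δ' → δ' < δ → P y ε (δ - δ')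

record UniformlyContinuousPredicate (P : ℝ → ℝ → ℝ → Set) : Set where
  field
    continuous : ContinuousPredicate P
    uniform    : (ε : ℝ) → 0ℝ < ε →
                 Σ ℝ λ δ → (0ℝ < δ) × ((x : ℝ) → x ∈[0,1] → P x ε δ)

CPisUC : Set₁
CPisUC = (P : ℝ → ℝ → ℝ → Set) → ContinuousPredicate P → UniformlyContinuousPredicate P

prefix : (ℕ → Bool) → ℕ → List Bool
prefix α N = map α (upTo N)

IsBar : (List Bool → Set) → Set
IsBar B = (α : ℕ → Bool) → Σ ℕ λ N → B (prefix α N)

IsUniform : (List Bool → Set) → Set
IsUniform B = Σ ℕ λ N → (α : ℕ → Bool) → Σ ℕ λ n → (n ℕ.≤ N) × B (prefix α n)

FanTheorem : Set₁
FanTheorem = (B : List Bool → Set) → IsBar B → IsUniform B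

module Submission where

-- Both directions run through one construction.  For rationals h, r with
-- h + r = 1 and 0 < r ≤ 2/3, a binary word b₀…b_{n-1} names the interval
-- I_u = [left u, left u + rⁿ] ⊆ [0,1], where left (b ∷ u) = b·h + r·left u.
-- The intervals along an infinite sequence α are nested and shrink, so they
-- determine a point `point α` of [0,1].
--
--  * FT ⇒ UC uses h = 1/3, r = 2/3: the two halves of each interval overlap,
--    so a real x ∈ [0,1] can be followed down the tree by approximate
--    comparisons (`digits`), and x lies in every I_{ᾱ(n)} for α = digits x.
--    For fixed ε, the words u admitting a δ that works on all of I_u form a
--    bar (continuity at `point α` plus the shift axiom); FT makes it uniform,
--    and the minimum of the finitely many δ's works everywhere.
--  * UC ⇒ FT uses h = 2/3, r = 1/3: the halves are separated by a gap, so
--    points close to x share the digits of x.  Given a bar B, the predicate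
--    "every point α within δ of x has a prefix in B of length n with δ ≤ rⁿ"
--    is continuous; a uniform δ for it bounds the length of the bar prefixes.

open import Defs renaming (_<_ to _<ℝ_; _≤_ to _≤ℝ_; _+_ to _+ℝ_; -_ to -ℝ_; _-_ to _-ℝ_; _≃_ to _≃ℝ_)
open import Function.Bundles using (_⇔_; mk⇔)
open import Data.Nat as ℕ using (ℕ; zero; suc; _⊔_; z≤n; s≤s)
import Data.Nat.Properties as ℕP
import Data.Integer as ℤ
import Data.Integer.Tactic.RingSolver as ℤSolver
import Data.Rational.Unnormalised as ℚᵘ
import Data.Rational.Unnormalised.Properties as ℚᵘP
open import Data.Nat.Coprimality as Coprime using (1-coprimeTo)
open import Data.Rational using (ℚ; 0ℚ; 1ℚ; ½; _+_; _*_; -_; _-_; _<_; _≤_; _⊓_; ∣_∣; _/_; mkℚ; positive; nonNegative; 1/_; *≤*; *<*)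
open import Data.Rational.Properties
open import Data.Product using (Σ; _×_; _,_; proj₁; proj₂)
open import Data.Sum using (_⊎_; inj₁; inj₂)
open import Data.Bool using (Bool; true; false)
open import Data.List using (List; []; _∷_; map; applyUpTo; length)
open import Data.Empty using (⊥-elim)
open import Relation.Nullary using (¬_; yes; no; Dec)
open import Relation.Nullary.Decidable using (isNo; dec⇒maybe)
open import Relation.Binary.PropositionalEquality
open import Level using (0ℓ)
open import Tactic.RingSolver using (solve-∀)
open import Tactic.RingSolver.Core.AlmostCommutativeRing using (AlmostCommutativeRing; fromCommutativeRing)

ℚ-ring : AlmostCommutativeRing 0ℓ 0ℓ
ℚ-ring = fromCommutativeRing +-*-commutativeRing (λ x → dec⇒maybe (0ℚ ≟ x))

pos : ℚ → Set
pos q = 0ℚ < q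

≤-via : ∀ {L R A B} → A ≤ B → L ≡ R + (A - B) → L ≤ R
≤-via {L} {R} {A} {B} A≤B eq =
  subst (_≤ R) (sym eq) (≤-trans (+-monoʳ-≤ R A-B≤0) (≤-reflexive (+-identityʳ R)))
  where
  A-B≤0 : A - B ≤ 0ℚ
  A-B≤0 = ≤-trans (+-monoˡ-≤ (- B) A≤B) (≤-reflexive (+-inverseʳ B))

<-via : ∀ {L R A B} → A < B → L ≡ R + (A - B) → L < R
<-via {L} {R} {A} {B} A<B eq =
  subst (_< R) (sym eq) (<-≤-trans (+-monoʳ-< R A-B<0) (≤-reflexive (+-identityʳ R)))
  where
  A-B<0 : A - B < 0ℚ
  A-B<0 = <-≤-trans (+-monoˡ-< (- B) A<B) (≤-reflexive (+-inverseʳ B))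

neg-neg : ∀ p → - (- p) ≡ p
neg-neg = solve-∀ ℚ-ring

∣∣<-split : ∀ {p e} → ∣ p ∣ < e → (p < e) × (- p < e)
∣∣<-split {p} {e} h with ∣p∣≡p∨∣p∣≡-p p
... | inj₁ eq = p<e , ≤-<-trans (≤-trans (neg-antimono-≤ 0≤p) 0≤p) p<e
  where
  p<e : p < e
  p<e = subst (_< e) eq h
  0≤p : 0ℚ ≤ p
  0≤p = subst (0ℚ ≤_) eq (0≤∣p∣ p)
... | inj₂ eq = ≤-<-trans (≤-trans p≤0 0≤-p) -p<e , -p<e
  where
  -p<e : - p < e
  -p<e = subst (_< e) eq h
  0≤-p : 0ℚ ≤ - p
  0≤-p = subst (0ℚ ≤_) eq (0≤∣p∣ p)
  p≤0 : p ≤ 0ℚ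
  p≤0 = subst (_≤ 0ℚ) (neg-neg p) (neg-antimono-≤ 0≤-p)

∣∣<-intro : ∀ {p e} → p < e → - p < e → ∣ p ∣ < e
∣∣<-intro {p} {e} p<e -p<e with ∣p∣≡p∨∣p∣≡-p p
... | inj₁ eq = subst (_< e) (sym eq) p<e
... | inj₂ eq = subst (_< e) (sym eq) -p<e

¼ ⅓ ⅔ ¹⁄₁₂ : ℚ
¼ = ℤ.+ 1 / 4
⅓ = ℤ.+ 1 / 3
⅔ = ℤ.+ 2 / 3
¹⁄₁₂ = ℤ.+ 1 / 12

pos-* : ∀ {c} → pos c → ∀ {e} → pos e → pos (e * c)
pos-* {c} pc {e} pe = subst (_< e * c) (*-zeroˡ c) (*-monoˡ-<-pos c {{positive pc}} pe)

pos-*½ : ∀ {e} → pos e → pos (e * ½)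
pos-*½ = pos-* (positive⁻¹ ½)

pos-*¼ : ∀ {e} → pos e → pos (e * ¼)
pos-*¼ = pos-* (positive⁻¹ ¼)

Eventually : (ℕ → Set) → Set
Eventually P = Σ ℕ λ N → ∀ n → N ℕ.≤ n → P n

Eventually₂ : (ℕ → ℕ → Set) → Set
Eventually₂ P = Σ ℕ λ N → ∀ m n → N ℕ.≤ m → N ℕ.≤ n → P m n

ev-both : ∀ {P Q : ℕ → Set} → Eventually P → Eventually Q → Eventually (λ n → P n × Q n)
ev-both (N , p) (M , q) =
  N ⊔ M , λ n le → p n (ℕP.≤-trans (ℕP.m≤m⊔n N M) le) , q n (ℕP.≤-trans (ℕP.m≤n⊔m N M) le)

ev-map : ∀ {P Q : ℕ → Set} → (∀ n → P n → Q n) → Eventually P → Eventually Q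
ev-map f (N , p) = N , λ n le → f n (p n le)

ev₂-both : ∀ {P Q : ℕ → ℕ → Set} → Eventually₂ P → Eventually₂ Q → Eventually₂ (λ m n → P m n × Q m n)
ev₂-both (N , p) (M , q) = N ⊔ M , λ m n lm ln →
  p m n (ℕP.≤-trans (ℕP.m≤m⊔n N M) lm) (ℕP.≤-trans (ℕP.m≤m⊔n N M) ln) ,
  q m n (ℕP.≤-trans (ℕP.m≤n⊔m N M) lm) (ℕP.≤-trans (ℕP.m≤n⊔m N M) ln)

ev₂-map : ∀ {P Q : ℕ → ℕ → Set} → (∀ m n → P m n → Q m n) → Eventually₂ P → Eventually₂ Q
ev₂-map f (N , p) = N , λ m n lm ln → f m n (p m n lm ln)

ev₂-first : ∀ {P : ℕ → Set} → Eventually P → Eventually₂ (λ m n → P m)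
ev₂-first (N , p) = N , λ m n lm _ → p m lm

cauchy₂ : ∀ x e → pos e → Eventually₂ (λ m n → (seq x m - seq x n < e) × (- (seq x m - seq x n) < e))
cauchy₂ x e pe = ev₂-map (λ m n → ∣∣<-split) (cauchy x e pe)

-- x ≤ y gives x_n ≤ y_n + η eventually, for every η > 0: at an index n
-- past both Cauchy moduli for η/4, a violation would give y + η/4 ≤ x.
≤ℝ-approx : ∀ {x y} → x ≤ℝ y → ∀ η → pos η → Eventually (λ n → seq x n ≤ seq y n + η)
≤ℝ-approx {x} {y} x≤y η pη = N , approx
  where
  e = η * ¼
  pe : pos e
  pe = pos-*¼ pη
  C = ev₂-both (cauchy₂ x e pe) (cauchy₂ y e pe)
  N = proj₁ C
  approx : ∀ n → N ℕ.≤ n → seq x n ≤ seq y n + η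
  approx n Nn with seq x n ≤? seq y n + η
  ... | yes x≤y+η = x≤y+η
  ... | no x≰y+η = ⊥-elim (x≤y (e , pe , n , y+e≤x))
    where
    identity : ∀ (a b c d h : ℚ) → a + h * ¼ ≡ b + ((((a - c) + (- (b - d))) + ((c + h) + 0ℚ)) - ((h * ¼ + h * ¼) + (d + h * ¼)))
    identity = solve-∀ ℚ-ring
    y+e≤x : ∀ m → n ℕ.≤ m → seq y m + e ≤ seq x m
    y+e≤x m nm = ≤-via
      (<⇒≤ (+-mono-< (+-mono-< (proj₁ (proj₂ Cmn)) (proj₂ (proj₁ Cmn))) (+-mono-< (≰⇒> x≰y+η) pe)))
      (identity (seq y m) (seq x m) (seq y n) (seq x n) η)
      where
      Cmn = proj₂ C m n (ℕP.≤-trans Nn nm) Nn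

≤ℝ-intro : ∀ {x y} → (∀ η → pos η → Eventually (λ n → seq x n ≤ seq y n + η)) → x ≤ℝ y
≤ℝ-intro {x} {y} approx (ε , pε , y+ε≤x) with approx (ε * ½) (pos-*½ pε)
... | M , x≤y+ε/2 = <-irrefl refl (≤-<-trans (x≤y+ε/2 n (ℕP.m≤n⊔m N M)) (<-≤-trans half<ε (proj₂ y+ε≤x n (ℕP.m≤m⊔n N M))))
  where
  N = proj₁ y+ε≤x
  n = N ⊔ M
  identity : ∀ (a : ℚ) → a * ½ ≡ a + (0ℚ - a * ½)
  identity = solve-∀ ℚ-ring
  half<ε : seq y n + ε * ½ < seq y n + ε
  half<ε = +-monoʳ-< (seq y n) (<-via (pos-*½ pε) (identity ε))

≤ℝ-eventually : ∀ {x y} → Eventually (λ n → seq x n ≤ seq y n) → x ≤ℝ y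
≤ℝ-eventually {x} {y} x≤y = ≤ℝ-intro {x} {y} λ η pη → ev-map (λ n p → ≤-trans p (≤-via (<⇒≤ pη) (identity (seq y n) η))) x≤y
  where
  identity : ∀ (a h : ℚ) → a ≡ (a + h) + (0ℚ - h)
  identity = solve-∀ ℚ-ring

≤ℝ-trans : ∀ {a b c} → a ≤ℝ b → b ≤ℝ c → a ≤ℝ c
≤ℝ-trans {a} {b} {c} a≤b b≤c = ≤ℝ-intro {a} {c} λ η pη →
  ev-map (λ n p → ≤-via (+-mono-≤ (proj₁ p) (proj₂ p)) (identity (seq a n) (seq b n) (seq c n) η))
         (ev-both (≤ℝ-approx {a} {b} a≤b (η * ½) (pos-*½ pη)) (≤ℝ-approx {b} {c} b≤c (η * ½) (pos-*½ pη)))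
  where
  identity : ∀ a b c η → a ≡ (c + η) + ((a + b) - ((b + η * ½) + (c + η * ½)))
  identity = solve-∀ ℚ-ring

≃ℝ-pointwise : ∀ {a b} → (∀ n → seq a n ≡ seq b n) → a ≃ℝ b
≃ℝ-pointwise {a} {b} eq = ≤ℝ-eventually {a} {b} (0 , λ n _ → ≤-reflexive (eq n)) , ≤ℝ-eventually {b} {a} (0 , λ n _ → ≤-reflexive (sym (eq n)))

≃ℝ-refl : ∀ x → x ≃ℝ x
≃ℝ-refl x = ≃ℝ-pointwise {x} {x} λ _ → refl

fromℚ-mono-≤ : ∀ {p q} → p ≤ q → fromℚ p ≤ℝ fromℚ q
fromℚ-mono-≤ {p} {q} p≤q = ≤ℝ-eventually {fromℚ p} {fromℚ q} (0 , λ _ _ → p≤q)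

fromℚ-pos : ∀ {q} → pos q → 0ℝ <ℝ fromℚ q
fromℚ-pos {q} pq = q , pq , 0 , λ _ _ → ≤-reflexive (+-identityˡ q)

∣∣<-self : ∀ y {d} → 0ℝ <ℝ d → ∣ y -ℝ y ∣< d
∣∣<-self y {d} (e , pe , 0+e≤d) =
  (e , pe , ev-map (λ n p → ≤-via p (identity₁ (seq y n) (seq d n) e)) 0+e≤d) ,
  (e , pe , ev-map (λ n p → ≤-via p (identity₂ (seq y n) (seq d n) e)) 0+e≤d)
  where
  identity₁ : ∀ y d e → (y - y) + e ≡ d + ((0ℚ + e) - d)
  identity₁ = solve-∀ ℚ-ring
  identity₂ : ∀ y d e → (- (y - y)) + e ≡ d + ((0ℚ + e) - d)
  identity₂ = solve-∀ ℚ-ring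

sub-pos : ∀ {δ δ''} → δ'' <ℝ δ → 0ℝ <ℝ δ -ℝ δ''
sub-pos {δ} {δ''} (e , pe , δ''+e≤δ) = e , pe , ev-map (λ n p → ≤-via p (identity (seq δ n) (seq δ'' n) e)) δ''+e≤δ
  where
  identity : ∀ a b e → 0ℚ + e ≡ (a - b) + ((b + e) - a)
  identity = solve-∀ ℚ-ring

sub-< : ∀ {δ δ''} → 0ℝ <ℝ δ'' → δ -ℝ δ'' <ℝ δ
sub-< {δ} {δ''} (e , pe , e≤δ'') = e , pe , ev-map (λ n p → ≤-via p (identity (seq δ n) (seq δ'' n) e)) e≤δ''
  where
  identity : ∀ a b e → (a - b) + e ≡ a + ((0ℚ + e) - b)
  identity = solve-∀ ℚ-ring

-- A bound on an absolute value is nonnegative: from u + e₁ ≤ d and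
-- -u + e₂ ≤ d with e₁, e₂ > 0, a negative d would give d + d < d + d.
∣∣<-nonneg-ℚ : ∀ {u d e₁ e₂ : ℚ} → pos e₁ → pos e₂ → u + e₁ ≤ d → (- u) + e₂ ≤ d → 0ℚ ≤ d
∣∣<-nonneg-ℚ {u} {d} {e₁} {e₂} pe₁ pe₂ u<d -u<d with 0ℚ ≤? d
... | yes 0≤d = 0≤d
... | no 0≰d = ⊥-elim (<-irrefl refl (≤-<-trans (+-mono-≤ u<d -u<d) d+d<))
  where
  d<0 : d < 0ℚ
  d<0 = ≰⇒> 0≰d
  identity : ∀ u d e₁ e₂ → d + d ≡ ((u + e₁) + ((- u) + e₂)) + (((d + d) + (0ℚ + 0ℚ)) - ((0ℚ + 0ℚ) + (e₁ + e₂)))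
  identity = solve-∀ ℚ-ring
  d+d< : d + d < (u + e₁) + ((- u) + e₂)
  d+d< = <-via (+-mono-< (+-mono-< d<0 d<0) (+-mono-< pe₁ pe₂)) (identity u d e₁ e₂)

∣∣<-nonneg : ∀ {u d} → ∣ u ∣< d → 0ℝ ≤ℝ d
∣∣<-nonneg {u} {d} ((e₁ , pe₁ , u<d) , (e₂ , pe₂ , -u<d)) =
  ≤ℝ-eventually {0ℝ} {d} (ev-map (λ n p → ∣∣<-nonneg-ℚ {seq u n} pe₁ pe₂ (proj₁ p) (proj₂ p)) (ev-both u<d -u<d))

sub-nonneg-≤ : ∀ {δ δ' q} → δ ≤ℝ q → 0ℝ ≤ℝ δ' → δ -ℝ δ' ≤ℝ q
sub-nonneg-≤ {δ} {δ'} {q} δ≤q 0≤δ' = ≤ℝ-intro {δ -ℝ δ'} {q} λ η pη →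
  ev-map (λ n p → ≤-via (+-mono-≤ (proj₁ p) (proj₂ p)) (identity (seq δ n) (seq δ' n) (seq q n) η))
         (ev-both (≤ℝ-approx {δ} {q} δ≤q (η * ½) (pos-*½ pη)) (≤ℝ-approx {0ℝ} {δ'} 0≤δ' (η * ½) (pos-*½ pη)))
  where
  identity : ∀ a b q η → a - b ≡ (q + η) + ((a + 0ℚ) - ((q + η * ½) + (b + η * ½)))
  identity = solve-∀ ℚ-ring

∣∣<-triangle : ∀ z y x δ δ' → ∣ z -ℝ y ∣< (δ -ℝ δ') → ∣ x -ℝ y ∣< δ' → ∣ z -ℝ x ∣< δ
∣∣<-triangle z y x δ δ' ((e₁ , pe₁ , zy<) , (e₂ , pe₂ , -zy<)) ((e₃ , pe₃ , xy<) , (e₄ , pe₄ , -xy<)) =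
  (e₁ , pe₁ , ev-map (λ n p → ≤-via (+-mono-≤ (+-mono-≤ (proj₁ p) (proj₂ p)) (<⇒≤ pe₄))
                                   (identity₁ (seq z n) (seq y n) (seq x n) (seq δ n) (seq δ' n) e₁ e₄))
                     (ev-both zy< -xy<)) ,
  (e₂ , pe₂ , ev-map (λ n p → ≤-via (+-mono-≤ (+-mono-≤ (proj₁ p) (proj₂ p)) (<⇒≤ pe₃))
                                   (identity₂ (seq z n) (seq y n) (seq x n) (seq δ n) (seq δ' n) e₂ e₃))
                     (ev-both -zy< xy<))
  where
  identity₁ : ∀ z y x d d' e₁ e₄ → (z - x) + e₁ ≡ d + (((((z - y) + e₁) + ((- (x - y)) + e₄)) + 0ℚ) - (((d - d') + d') + e₄))
  identity₁ = solve-∀ ℚ-ring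
  identity₂ : ∀ z y x d d' e₂ e₃ → (- (z - x)) + e₂ ≡ d + (((((- (z - y)) + e₂) + ((x - y) + e₃)) + 0ℚ) - (((d - d') + d') + e₃))
  identity₂ = solve-∀ ℚ-ring

∣∣<-resp : ∀ z x x' d d' → x ≃ℝ x' → d ≃ℝ d' → ∣ z -ℝ x' ∣< d' → ∣ z -ℝ x ∣< d
∣∣<-resp z x x' d d' (x≤x' , x'≤x) (d≤d' , d'≤d) ((e₁ , pe₁ , zx'<) , (e₂ , pe₂ , -zx'<)) =
  (e₁ * ½ , pos-*½ pe₁ ,
    ev-map (λ n p → ≤-via (+-mono-≤ (+-mono-≤ (proj₁ p) (proj₁ (proj₂ p))) (proj₂ (proj₂ p)))
                          (identity₁ (seq z n) (seq x n) (seq x' n) (seq d n) (seq d' n) e₁))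
           (ev-both zx'< (ev-both (≤ℝ-approx {x'} {x} x'≤x (e₁ * ¼) (pos-*¼ pe₁))
                                  (≤ℝ-approx {d'} {d} d'≤d (e₁ * ¼) (pos-*¼ pe₁))))) ,
  (e₂ * ½ , pos-*½ pe₂ ,
    ev-map (λ n p → ≤-via (+-mono-≤ (+-mono-≤ (proj₁ p) (proj₁ (proj₂ p))) (proj₂ (proj₂ p)))
                          (identity₂ (seq z n) (seq x n) (seq x' n) (seq d n) (seq d' n) e₂))
           (ev-both -zx'< (ev-both (≤ℝ-approx {x} {x'} x≤x' (e₂ * ¼) (pos-*¼ pe₂))
                                   (≤ℝ-approx {d'} {d} d'≤d (e₂ * ¼) (pos-*¼ pe₂)))))
  where
  identity₁ : ∀ z x x' d d' e → (z - x) + e * ½ ≡ d + ((((z - x') + e) + x' + d') - ((d' + (x + e * ¼)) + (d + e * ¼)))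
  identity₁ = solve-∀ ℚ-ring
  identity₂ : ∀ z x x' d d' e → (- (z - x)) + e * ½ ≡ d + (((((- (z - x')) + e) + x) + d') - ((d' + (x' + e * ¼)) + (d + e * ¼)))
  identity₂ = solve-∀ ℚ-ring

-- Natural numbers as rationals, in normal form so that `1/` computes on them.
fromℕ : ℕ → ℚ
fromℕ m = mkℚ (ℤ.+ m) 0 (Coprime.sym (1-coprimeTo m))

fromℕ-suc : ∀ m → fromℕ (suc m) ≡ fromℕ m + 1ℚ
fromℕ-suc m = toℚᵘ-injective (ℚᵘP.≃-trans (ℚᵘ.*≡* numerators) (ℚᵘP.≃-sym (toℚᵘ-homo-+ (fromℕ m) 1ℚ)))
  where
  identity : ∀ (z : ℤ.ℤ) → (z ℤ.+ ℤ.+ 1) ℤ.* ℤ.+ 1 ≡ (z ℤ.* ℤ.+ 1 ℤ.+ ℤ.+ 1 ℤ.* ℤ.+ 1) ℤ.* ℤ.+ 1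
  identity = ℤSolver.solve-∀
  numerators : ℤ.+ suc m ℤ.* ℤ.+ 1 ≡ (ℤ.+ m ℤ.* ℤ.+ 1 ℤ.+ ℤ.+ 1 ℤ.* ℤ.+ 1) ℤ.* ℤ.+ 1
  numerators = trans (cong (λ z → ℤ.+_ z ℤ.* ℤ.+ 1) (ℕP.+-comm 1 m)) (identity (ℤ.+ m))

fromℕ-+ : ∀ a b → fromℕ (a ℕ.+ b) ≡ fromℕ a + fromℕ b
fromℕ-+ zero b = sym (+-identityˡ (fromℕ b))
fromℕ-+ (suc a) b = begin
  fromℕ (suc (a ℕ.+ b))          ≡⟨ fromℕ-suc (a ℕ.+ b) ⟩
  fromℕ (a ℕ.+ b) + 1ℚ           ≡⟨ cong (_+ 1ℚ) (fromℕ-+ a b) ⟩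
  (fromℕ a + fromℕ b) + 1ℚ       ≡⟨ identity (fromℕ a) (fromℕ b) ⟩
  (fromℕ a + 1ℚ) + fromℕ b       ≡⟨ cong (_+ fromℕ b) (sym (fromℕ-suc a)) ⟩
  fromℕ (suc a) + fromℕ b        ∎
  where
  open ≡-Reasoning
  identity : ∀ x y → (x + y) + 1ℚ ≡ (x + 1ℚ) + y
  identity = solve-∀ ℚ-ring

fromℕ-nonneg : ∀ m → 0ℚ ≤ fromℕ m
fromℕ-nonneg m = nonNegative⁻¹ (fromℕ m)

unit-fraction-below : ∀ ε → pos ε → Σ ℕ λ d → 1/ (fromℕ (suc d)) ≤ ε
unit-fraction-below (mkℚ (ℤ.+ suc n) d _) _ = d , *≤* (ℤ.+≤+ (ℕP.*-monoˡ-≤ (suc d) (s≤s (z≤n {n}))))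
unit-fraction-below (mkℚ (ℤ.+ zero) d _) (*<* (ℤ.+<+ ()))
unit-fraction-below (mkℚ ℤ.-[1+ n ] d _) (*<* ())

infixr 8 _^_
_^_ : ℚ → ℕ → ℚ
r ^ zero = 1ℚ
r ^ suc k = r * r ^ k

^-nonneg : ∀ {r} → 0ℚ ≤ r → ∀ k → 0ℚ ≤ r ^ k
^-nonneg 0≤r zero = nonNegative⁻¹ 1ℚ
^-nonneg {r} 0≤r (suc k) = subst (_≤ r * r ^ k) (*-zeroʳ r) (*-monoˡ-≤-nonNeg r {{nonNegative 0≤r}} (^-nonneg 0≤r k))

-- Bernoulli's inequality in the form needed: for 0 ≤ r ≤ 2/3,
-- rᵏ (2 + k) ≤ 2, since (2/3)(3 + k) ≤ 2 + k.
^-bernoulli : ∀ {r} → 0ℚ ≤ r → r ≤ ⅔ → ∀ k → r ^ k * (fromℕ 2 + fromℕ k) ≤ fromℕ 2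
^-bernoulli 0≤r r≤⅔ zero = ≤-refl
^-bernoulli {r} 0≤r r≤⅔ (suc k) = ≤-trans (≤-trans r≤⅔-step ⅔-step) (^-bernoulli 0≤r r≤⅔ k)
  where
  p = r ^ k
  0≤p = ^-nonneg 0≤r k
  Q = fromℕ 2 + fromℕ (suc k)
  0≤Q : 0ℚ ≤ Q
  0≤Q = subst (_≤ Q) (+-identityˡ 0ℚ) (+-mono-≤ (fromℕ-nonneg 2) (fromℕ-nonneg (suc k)))
  r≤⅔-step : (r * p) * Q ≤ (⅔ * p) * Q
  r≤⅔-step = *-monoʳ-≤-nonNeg Q {{nonNegative 0≤Q}} (*-monoʳ-≤-nonNeg p {{nonNegative 0≤p}} r≤⅔)
  k/3≥0 : 0ℚ ≤ p * (fromℕ k * ⅓)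
  k/3≥0 = subst (_≤ p * (fromℕ k * ⅓)) (*-zeroʳ p)
            (*-monoˡ-≤-nonNeg p {{nonNegative 0≤p}}
              (subst (_≤ fromℕ k * ⅓) (*-zeroˡ ⅓) (*-monoʳ-≤-nonNeg ⅓ (fromℕ-nonneg k))))
  identity : ∀ p i → (⅔ * p) * (fromℕ 2 + (i + 1ℚ)) ≡ p * (fromℕ 2 + i) + (0ℚ - p * (i * ⅓))
  identity = solve-∀ ℚ-ring
  ⅔-step : (⅔ * p) * Q ≤ p * (fromℕ 2 + fromℕ k)
  ⅔-step = subst (λ z → (⅔ * p) * (fromℕ 2 + z) ≤ p * (fromℕ 2 + fromℕ k)) (sym (fromℕ-suc k))
             (≤-via k/3≥0 (identity p (fromℕ k)))

-- Powers of a ratio 0 ≤ r ≤ 2/3 become arbitrarily small: with ε ≥ 1/(d+1)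
-- and k = 2(d+1), Bernoulli gives rᵏ ≤ 1/(d+2) < ε.
^-small : ∀ {r} → 0ℚ ≤ r → r ≤ ⅔ → ∀ ε → pos ε → Σ ℕ λ k → r ^ k < ε
^-small {r} 0≤r r≤⅔ ε pε with unit-fraction-below ε pε
... | d , e≤ε = k , <-≤-trans rᵏ<e e≤ε
  where
  I = fromℕ (suc d)
  e = 1/ I
  k = suc d ℕ.+ suc d
  Q = fromℕ 2 + fromℕ k
  identity : ∀ x y → x * (fromℕ 2 + (y + y)) ≡ x * fromℕ 2 + (x * y + x * y)
  identity = solve-∀ ℚ-ring
  eQ : e * Q ≡ e * fromℕ 2 + fromℕ 2
  eQ = begin
    e * (fromℕ 2 + fromℕ (suc d ℕ.+ suc d))  ≡⟨ cong (λ z → e * (fromℕ 2 + z)) (fromℕ-+ (suc d) (suc d)) ⟩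
    e * (fromℕ 2 + (I + I))                  ≡⟨ identity e I ⟩
    e * fromℕ 2 + (e * I + e * I)            ≡⟨ cong (λ z → e * fromℕ 2 + (z + z)) (*-inverseˡ I) ⟩
    e * fromℕ 2 + fromℕ 2                    ∎
    where open ≡-Reasoning
  2<eQ : fromℕ 2 < e * Q
  2<eQ = subst (fromℕ 2 <_) (sym eQ)
           (subst (_< e * fromℕ 2 + fromℕ 2) (+-identityˡ (fromℕ 2))
             (+-monoˡ-< (fromℕ 2) (pos-* (positive⁻¹ (fromℕ 2)) (positive⁻¹ e))))
  0≤Q : 0ℚ ≤ Q
  0≤Q = subst (_≤ Q) (+-identityˡ 0ℚ) (+-mono-≤ (fromℕ-nonneg 2) (fromℕ-nonneg k))
  rᵏ<e : r ^ k < e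
  rᵏ<e = *-cancelʳ-<-nonNeg Q {{nonNegative 0≤Q}} (≤-<-trans (^-bernoulli 0≤r r≤⅔ k) 2<eQ)

-- ᾱ(n), by recursion on n: the form used to compute along the interval tree.
initial : (ℕ → Bool) → ℕ → List Bool
initial α zero = []
initial α (suc n) = α 0 ∷ initial (λ i → α (suc i)) n

prefix≡initial : ∀ α n → prefix α n ≡ initial α n
prefix≡initial α n = map-applyUpTo α (λ i → i) n
  where
  map-applyUpTo : ∀ (α : ℕ → Bool) (f : ℕ → ℕ) n → map α (applyUpTo f n) ≡ initial (λ i → α (f i)) n
  map-applyUpTo α f zero = refl
  map-applyUpTo α f (suc n) = cong (α (f 0) ∷_) (map-applyUpTo α (λ i → f (suc i)) n)

length-initial : ∀ α n → length (initial α n) ≡ n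
length-initial α zero = refl
length-initial α (suc n) = cong suc (length-initial (λ i → α (suc i)) n)

offset : Bool → ℚ → ℚ
offset true h = h
offset false h = 0ℚ

isNo-spec : ∀ {X : Set} (d : Dec X) → ((isNo d ≡ false) × X) ⊎ ((isNo d ≡ true) × ¬ X)
isNo-spec (yes x) = inj₁ (refl , x)
isNo-spec (no ¬x) = inj₂ (refl , ¬x)

module Intervals (h r : ℚ) (0≤h : 0ℚ ≤ h) (0<r : 0ℚ < r) (r≤⅔ : r ≤ ⅔) (h+r≡1 : h + r ≡ 1ℚ) where

  left : List Bool → ℚ
  left [] = 0ℚ
  left (b ∷ u) = offset b h + r * left u

  width : ℕ → ℚ
  width k = r ^ k

  left-end : (ℕ → Bool) → ℕ → ℚ
  left-end α n = left (initial α n)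

  0≤r : 0ℚ ≤ r
  0≤r = <⇒≤ 0<r

  r≤1 : r ≤ 1ℚ
  r≤1 = ≤-trans r≤⅔ (≤ᵇ⇒≤ _)

  r*-mono : ∀ {a b} → a ≤ b → r * a ≤ r * b
  r*-mono = *-monoˡ-≤-nonNeg r {{nonNegative 0≤r}}

  width-pos : ∀ k → pos (width k)
  width-pos zero = positive⁻¹ 1ℚ
  width-pos (suc k) = subst (_< r * width k) (*-zeroʳ r) (*-monoʳ-<-pos r {{positive 0<r}} (width-pos k))

  width≤1 : ∀ m → width m ≤ 1ℚ
  width≤1 zero = ≤-refl
  width≤1 (suc m) = ≤-trans (r*-mono (width≤1 m)) (≤-trans (≤-reflexive (*-identityʳ r)) r≤1)

  width-antitone : ∀ {k m} → k ℕ.≤ m → width m ≤ width k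
  width-antitone {zero} {m} _ = width≤1 m
  width-antitone {suc k} {suc m} (s≤s k≤m) = r*-mono (width-antitone k≤m)

  width-small : ∀ ε → pos ε → Σ ℕ λ k → width k < ε
  width-small = ^-small 0≤r r≤⅔

  offset-bounds : ∀ b → (0ℚ ≤ offset b h) × (offset b h ≤ h)
  offset-bounds true = 0≤h , ≤-refl
  offset-bounds false = ≤-refl , 0≤h

  interval⊆[0,1] : ∀ α m → (0ℚ ≤ left-end α m) × (left-end α m + width m ≤ 1ℚ)
  interval⊆[0,1] α zero = ≤-refl , ≤-reflexive (+-identityˡ 1ℚ)
  interval⊆[0,1] α (suc m) = lower , subst ((c + r * t) + r * width m ≤_) h+r≡1 upper
    where
    β = λ i → α (suc i)
    IH = interval⊆[0,1] β m
    t = left-end β m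
    c = offset (α 0) h
    lower : 0ℚ ≤ c + r * t
    lower = subst (_≤ c + r * t) (+-identityˡ 0ℚ)
              (+-mono-≤ (proj₁ (offset-bounds (α 0))) (subst (_≤ r * t) (*-zeroʳ r) (r*-mono (proj₁ IH))))
    identity : ∀ c t p h r → (c + r * t) + r * p ≡ (h + r) + ((c + r * (t + p)) - (h + r * 1ℚ))
    identity = solve-∀ ℚ-ring
    upper : (c + r * t) + r * width m ≤ h + r
    upper = ≤-via (+-mono-≤ (proj₂ (offset-bounds (α 0))) (r*-mono (proj₂ IH))) (identity c t (width m) h r)

  nested : ∀ α n m → n ℕ.≤ m → (left-end α n ≤ left-end α m) × (left-end α m + width m ≤ left-end α n + width n)
  nested α zero m _ = proj₁ (interval⊆[0,1] α m) , ≤-trans (proj₂ (interval⊆[0,1] α m)) (≤-reflexive (sym (+-identityˡ 1ℚ)))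
  nested α (suc n) (suc m) (s≤s n≤m) =
    +-monoʳ-≤ c (r*-mono (proj₁ IH)) ,
    ≤-via (r*-mono (proj₂ IH)) (identity c (left-end β m) (left-end β n) (width m) (width n) r)
    where
    β = λ i → α (suc i)
    IH = nested β n m n≤m
    c = offset (α 0) h
    identity : ∀ c tm tn pm pn r → (c + r * tm) + r * pm ≡ (c + r * tn) + r * pn + (r * (tm + pm) - r * (tn + pn))
    identity = solve-∀ ℚ-ring

  left-end-inside : ∀ α n m → n ℕ.≤ m → (left-end α n ≤ left-end α m) × (left-end α m ≤ left-end α n + width n)
  left-end-inside α n m n≤m =
    proj₁ (nested α n m n≤m) ,
    ≤-trans (≤-via (<⇒≤ (width-pos m)) (identity (left-end α m) (width m))) (proj₂ (nested α n m n≤m))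
    where
    identity : ∀ t p → t ≡ (t + p) + (0ℚ - p)
    identity = solve-∀ ℚ-ring

  left-end≤1 : ∀ α m → left-end α m ≤ 1ℚ
  left-end≤1 α m = ≤-via (+-mono-≤ (proj₂ (interval⊆[0,1] α m)) (<⇒≤ (width-pos m))) (identity (left-end α m) (width m))
    where
    identity : ∀ t p → t ≡ 1ℚ + (((t + p) + 0ℚ) - (1ℚ + p))
    identity = solve-∀ ℚ-ring

  -- The point named by α: the limit of the left ends, Cauchy because all
  -- left ends beyond k lie in I_{ᾱ(k)}, whose width tends to 0.
  point : (ℕ → Bool) → ℝ
  point α = mkℝ (left-end α) left-end-cauchy
    where
    identity₁ : ∀ a b c p e → a - b ≡ e + (((a + c) + p) - ((c + p + b) + e))
    identity₁ = solve-∀ ℚ-ring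
    identity₂ : ∀ a b → - (a - b) ≡ b - a
    identity₂ = solve-∀ ℚ-ring
    one-sided : ∀ k ε → width k < ε → ∀ m n → k ℕ.≤ m → k ℕ.≤ n → left-end α m - left-end α n < ε
    one-sided k ε wk<ε m n km kn =
      <-via (+-mono-≤-< (+-mono-≤ (proj₂ (left-end-inside α k m km)) (proj₁ (left-end-inside α k n kn))) wk<ε)
            (identity₁ (left-end α m) (left-end α n) (left-end α k) (width k) ε)
    left-end-cauchy : (ε : ℚ) → 0ℚ < ε → Σ ℕ λ N → (m n : ℕ) → N ℕ.≤ m → N ℕ.≤ n → ∣ left-end α m - left-end α n ∣ < ε
    left-end-cauchy ε pε = k , λ m n km kn →
      ∣∣<-intro (one-sided k ε wk<ε m n km kn)
                (subst (_< ε) (sym (identity₂ (left-end α m) (left-end α n))) (one-sided k ε wk<ε n m kn km))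
      where
      k = proj₁ (width-small ε pε)
      wk<ε = proj₂ (width-small ε pε)

  point∈[0,1] : ∀ α → point α ∈[0,1]
  point∈[0,1] α = ≤ℝ-eventually {0ℝ} {point α} (0 , λ n _ → proj₁ (interval⊆[0,1] α n)) ,
                  ≤ℝ-eventually {point α} {1ℝ} (0 , λ n _ → left-end≤1 α n)

  interval-close : ∀ α k y e → pos e → width k < e →
    fromℚ (left-end α k) ≤ℝ y → y ≤ℝ fromℚ (left-end α k + width k) → ∣ point α -ℝ y ∣< fromℚ (e + (e + e))
  interval-close α k y e pe wk<e lo hi =
    (e , pe , ev-map (λ n p → ≤-via (+-mono-≤ (+-mono-≤ (proj₂ (proj₁ p)) (proj₂ p)) (<⇒≤ wk<e))
                                   (identity₁ (left-end α n) (left-end α k) (width k) (seq y n) e))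
                     (ev-both later (≤ℝ-approx {fromℚ (left-end α k)} {y} lo e pe))) ,
    (e , pe , ev-map (λ n p → ≤-via (+-mono-≤ (+-mono-≤ (proj₂ p) (proj₁ (proj₁ p))) (<⇒≤ wk<e))
                                   (identity₂ (left-end α n) (left-end α k) (width k) (seq y n) e))
                     (ev-both later (≤ℝ-approx {y} {fromℚ (left-end α k + width k)} hi e pe)))
    where
    later : Eventually (λ n → (left-end α k ≤ left-end α n) × (left-end α n ≤ left-end α k + width k))
    later = k , left-end-inside α k
    identity₁ : ∀ tn tk w yn e → (tn - yn) + e ≡ (e + (e + e)) + (((tn + tk) + w) - (((tk + w) + (yn + e)) + e))
    identity₁ = solve-∀ ℚ-ring
    identity₂ : ∀ tn tk w yn e → - (tn - yn) + e ≡ (e + (e + e)) + (((yn + tk) + w) - ((((tk + w) + e) + tn) + e))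
    identity₂ = solve-∀ ℚ-ring

  -- Following a real y down the tree from [a, a + s]: the next digit is 0
  -- when an s/12-approximation of y lies below the midpoint a + s/2.
  digit : ℝ → (a s : ℚ) → pos s → Bool
  digit y a s ps = isNo (seq y (proj₁ (cauchy₂ y (s * ¹⁄₁₂) (pos-* (positive⁻¹ ¹⁄₁₂) ps))) <? a + s * ½)

  digits : ℝ → (a s : ℚ) → pos s → ℕ → Bool
  digits y a s ps zero = digit y a s ps
  digits y a s ps (suc k) = digits y (a + s * offset (digit y a s ps) h) (s * r) (pos-* 0<r ps) k

  address : ℝ → ℕ → Bool
  address x = digits x 0ℚ 1ℚ (positive⁻¹ 1ℚ)

PrefixWithin : ℕ → (List Bool → Set) → Set
PrefixWithin N Q = ∀ α → Σ ℕ λ n → n ℕ.≤ N × Q (initial α n)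

initial-bar : ∀ {Q : List Bool → Set} → IsBar Q → ∀ α → Σ ℕ λ n → Q (initial α n)
initial-bar {Q} bar α with bar α
... | n , q = n , subst Q (prefix≡initial α n) q

bar-from-initial : ∀ {Q : List Bool → Set} → (∀ α → Σ ℕ λ n → Q (initial α n)) → IsBar Q
bar-from-initial {Q} bar α with bar α
... | n , q = n , subst Q (sym (prefix≡initial α n)) q

uniform-within : ∀ {Q : List Bool → Set} → IsUniform Q → Σ ℕ λ N → PrefixWithin N Q
uniform-within {Q} (N , uniform) = N , λ α → within α (uniform α)
  where
  within : ∀ α → (Σ ℕ λ n → (n ℕ.≤ N) × Q (prefix α n)) → Σ ℕ λ n → n ℕ.≤ N × Q (initial α n)
  within α (n , n≤N , q) = n , n≤N , subst Q (prefix≡initial α n) q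

within-uniform : ∀ {N} {Q : List Bool → Set} → PrefixWithin N Q → IsUniform Q
within-uniform {N} {Q} within = N , λ α → uniform α (within α)
  where
  uniform : ∀ α → (Σ ℕ λ n → n ℕ.≤ N × Q (initial α n)) → Σ ℕ λ n → (n ℕ.≤ N) × Q (prefix α n)
  uniform α (n , n≤N , q) = n , n≤N , subst Q (sym (prefix≡initial α n)) q

⊓-pos : ∀ {p q} → pos p → pos q → pos (p ⊓ q)
⊓-pos {p} {q} pp pq with ⊓-sel p q
... | inj₁ eq = subst pos (sym eq) pp
... | inj₂ eq = subst pos (sym eq) pq

-- Induction on
-- N: split on the first digit and take the smaller of the two δ's.
uniform-min : ∀ N (G : List Bool → ℚ → Set) → (∀ u {δ δ'} → pos δ' → δ' ≤ δ → G u δ → G u δ') →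
  PrefixWithin N (λ u → Σ ℚ λ δ → pos δ × G u δ) → Σ ℚ λ δ → pos δ × PrefixWithin N (λ u → G u δ)
uniform-min zero G antitone within with within (λ _ → false)
... | zero , _ , δ , pδ , G[] = δ , pδ , λ α → 0 , z≤n , G[]
uniform-min (suc N) G antitone within = δ , pδ , λ α → lift α (proj₂ (proj₂ (IH (α 0))) (λ i → α (suc i)))
  where
  cons : Bool → (ℕ → Bool) → ℕ → Bool
  cons b β zero = b
  cons b β (suc i) = β i
  -- G for the subtree below digit b (or already for the empty prefix)
  G-below : Bool → List Bool → ℚ → Set
  G-below b u δ = G [] δ ⊎ G (b ∷ u) δ
  antitone-below : ∀ b u {δ δ'} → pos δ' → δ' ≤ δ → G-below b u δ → G-below b u δ'
  antitone-below b u pδ' le (inj₁ g) = inj₁ (antitone [] pδ' le g)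
  antitone-below b u pδ' le (inj₂ g) = inj₂ (antitone (b ∷ u) pδ' le g)
  within-below : ∀ b → PrefixWithin N (λ u → Σ ℚ λ δ → pos δ × G-below b u δ)
  within-below b β with within (cons b β)
  ... | zero , _ , δ , pδ , g = 0 , z≤n , δ , pδ , inj₁ g
  ... | suc n , s≤s n≤N , δ , pδ , g = n , n≤N , δ , pδ , inj₂ g
  IH : ∀ b → Σ ℚ λ δ → pos δ × PrefixWithin N (λ u → G-below b u δ)
  IH b = uniform-min N (G-below b) (antitone-below b) (within-below b)
  δ : ℚ
  δ = proj₁ (IH false) ⊓ proj₁ (IH true)
  pδ : pos δ
  pδ = ⊓-pos (proj₁ (proj₂ (IH false))) (proj₁ (proj₂ (IH true)))
  δ≤ : ∀ b → δ ≤ proj₁ (IH b)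
  δ≤ false = p⊓q≤p (proj₁ (IH false)) (proj₁ (IH true))
  δ≤ true = p⊓q≤q (proj₁ (IH false)) (proj₁ (IH true))
  lift : ∀ α → (Σ ℕ λ n → n ℕ.≤ N × G-below (α 0) (initial (λ i → α (suc i)) n) (proj₁ (IH (α 0)))) →
         Σ ℕ λ n → n ℕ.≤ suc N × G (initial α n) δ
  lift α (n , _ , inj₁ g) = 0 , z≤n , antitone [] pδ (δ≤ (α 0)) g
  lift α (n , n≤N , inj₂ g) = suc n , s≤s n≤N , antitone _ pδ (δ≤ (α 0)) g

margin : ∀ δ₀ e₀ → pos e₀ → Eventually (λ n → 0ℚ + e₀ ≤ seq δ₀ n) →
  let e = e₀ * ¼ in
  (fromℚ (e + (e + e)) <ℝ δ₀) × (∀ δ' → δ' ≤ e * ½ → fromℚ δ' <ℝ δ₀ -ℝ fromℚ (e + (e + e)))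
margin δ₀ e₀ pe₀ e₀≤δ₀ =
  (e₀ * ¼ , pos-*¼ pe₀ , ev-map (λ n p → ≤-via p (identity₁ (seq δ₀ n) e₀)) e₀≤δ₀) ,
  λ δ' δ'≤ → (e₀ * ¼) * ½ , pos-*½ (pos-*¼ pe₀) ,
             ev-map (λ n p → ≤-via (+-mono-≤ p δ'≤) (identity₂ (seq δ₀ n) e₀ δ')) e₀≤δ₀
  where
  identity₁ : ∀ d e₀ → (e₀ * ¼ + (e₀ * ¼ + e₀ * ¼)) + e₀ * ¼ ≡ d + ((0ℚ + e₀) - d)
  identity₁ = solve-∀ ℚ-ring
  identity₂ : ∀ d e₀ δ' → δ' + (e₀ * ¼) * ½ ≡ (d - (e₀ * ¼ + (e₀ * ¼ + e₀ * ¼))) + (((0ℚ + e₀) + δ') - (d + (e₀ * ¼) * ½))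
  identity₂ = solve-∀ ℚ-ring

module FT⇒UC (ft : FanTheorem) (P : ℝ → ℝ → ℝ → Set) (cp : ContinuousPredicate P) where
  open ContinuousPredicate cp
  -- overlapping halves [0, 2/3] and [1/3, 1]
  open Intervals ⅓ ⅔ (nonNegative⁻¹ ⅓) (positive⁻¹ ⅔) ≤-refl refl

  -- P is antitone in δ: shifting from y to y itself by δ - δ'' leaves
  -- δ - (δ - δ'') ≃ δ''.
  P-antitone : ∀ y ε δ δ'' → y ∈[0,1] → 0ℝ <ℝ ε → 0ℝ <ℝ δ → 0ℝ <ℝ δ'' → δ'' <ℝ δ → P y ε δ → P y ε δ''
  P-antitone y ε δ δ'' y∈ pε pδ pδ'' δ''<δ Pyεδ =
    extensional y y ε ε (δ -ℝ (δ -ℝ δ'')) δ'' (≃ℝ-refl y) (≃ℝ-refl ε) cancel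
      (shift y y ε δ (δ -ℝ δ'') y∈ y∈ pε pδ Pyεδ (∣∣<-self y {δ -ℝ δ''} (sub-pos {δ} {δ''} δ''<δ)) (sub-< {δ} {δ''} pδ''))
    where
    identity : ∀ a b → a - (a - b) ≡ b
    identity = solve-∀ ℚ-ring
    cancel : δ -ℝ (δ -ℝ δ'') ≃ℝ δ''
    cancel = ≃ℝ-pointwise {δ -ℝ (δ -ℝ δ'')} {δ''} λ n → identity (seq δ n) (seq δ'' n)

  -- One step of `digits`: if y ∈ [a, a + s], then y lies in the chosen
  -- two-thirds subinterval, because the approximation of y is s/12-accurate.
  digit-step : ∀ y a s ps → fromℚ a ≤ℝ y → y ≤ℝ fromℚ (a + s) →
    let a' = a + s * offset (digit y a s ps) ⅓ in (fromℚ a' ≤ℝ y) × (y ≤ℝ fromℚ (a' + s * ⅔))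
  digit-step y a s ps lo hi = by-digit (isNo-spec (seq y M <? a + s * ½))
    where
    approx = cauchy₂ y (s * ¹⁄₁₂) (pos-* (positive⁻¹ ¹⁄₁₂) ps)
    M = proj₁ approx
    near : ∀ n → M ℕ.≤ n → (seq y n - seq y M < s * ¹⁄₁₂) × (- (seq y n - seq y M) < s * ¹⁄₁₂)
    near n Mn = proj₂ approx n M Mn ℕP.≤-refl
    InSub : Bool → Set
    InSub b = (fromℚ (a + s * offset b ⅓) ≤ℝ y) × (y ≤ℝ fromℚ ((a + s * offset b ⅓) + s * ⅔))
    0≤s/12 : 0ℚ ≤ s * ¹⁄₁₂
    0≤s/12 = <⇒≤ (pos-* (positive⁻¹ ¹⁄₁₂) ps)
    identity₁ : ∀ a s → a ≡ a + s * 0ℚ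
    identity₁ = solve-∀ ℚ-ring
    identity₂ : ∀ yn ym a s → yn ≡ ((a + s * 0ℚ) + s * ⅔) + ((((yn - ym) + ym) + 0ℚ) - ((s * ¹⁄₁₂ + (a + s * ½)) + s * ¹⁄₁₂))
    identity₂ = solve-∀ ℚ-ring
    identity₃ : ∀ yn ym a s → a + s * ⅓ ≡ yn + ((((- (yn - ym)) + (a + s * ½)) + 0ℚ) - ((s * ¹⁄₁₂ + ym) + s * ¹⁄₁₂))
    identity₃ = solve-∀ ℚ-ring
    identity₄ : ∀ a s → a + s ≡ (a + s * ⅓) + s * ⅔
    identity₄ = solve-∀ ℚ-ring
    -- y_M < a + s/2, so y < a + 2s/3
    lower : seq y M < a + s * ½ → InSub false
    lower yM< = subst (λ z → fromℚ z ≤ℝ y) (identity₁ a s) lo ,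
                ≤ℝ-eventually {y} {fromℚ ((a + s * 0ℚ) + s * ⅔)} (M , λ n Mn →
                  ≤-via (+-mono-≤ (<⇒≤ (+-mono-< (proj₁ (near n Mn)) yM<)) 0≤s/12) (identity₂ (seq y n) (seq y M) a s))
    -- y_M ≥ a + s/2, so y > a + s/3
    upper : ¬ (seq y M < a + s * ½) → InSub true
    upper yM≮ = ≤ℝ-eventually {fromℚ (a + s * ⅓)} {y} (M , λ n Mn →
                  ≤-via (+-mono-≤ (+-mono-≤ (<⇒≤ (proj₂ (near n Mn))) (≮⇒≥ yM≮)) 0≤s/12) (identity₃ (seq y n) (seq y M) a s)) ,
                subst (λ z → y ≤ℝ fromℚ z) (identity₄ a s) hi
    by-digit : ((digit y a s ps ≡ false) × (seq y M < a + s * ½)) ⊎ ((digit y a s ps ≡ true) × ¬ (seq y M < a + s * ½)) →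
               InSub (digit y a s ps)
    by-digit (inj₁ (eq , yM<)) = subst InSub (sym eq) (lower yM<)
    by-digit (inj₂ (eq , yM≮)) = subst InSub (sym eq) (upper yM≮)

  digits-track : ∀ y k a s ps → fromℚ a ≤ℝ y → y ≤ℝ fromℚ (a + s) →
    let α = digits y a s ps in
    (fromℚ (a + s * left-end α k) ≤ℝ y) × (y ≤ℝ fromℚ (a + s * (left-end α k + width k)))
  digits-track y zero a s ps lo hi =
    subst (λ z → fromℚ z ≤ℝ y) (identity₁ a s) lo , subst (λ z → y ≤ℝ fromℚ z) (identity₂ a s) hi
    where
    identity₁ : ∀ a s → a ≡ a + s * 0ℚ
    identity₁ = solve-∀ ℚ-ring
    identity₂ : ∀ a s → a + s ≡ a + s * (0ℚ + 1ℚ)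
    identity₂ = solve-∀ ℚ-ring
  digits-track y (suc k) a s ps lo hi =
    subst (λ z → fromℚ z ≤ℝ y) (sym (identity₁ a s c t)) (proj₁ IH) ,
    subst (λ z → y ≤ℝ fromℚ z) (sym (identity₂ a s c t (width k))) (proj₂ IH)
    where
    c = offset (digit y a s ps) ⅓
    step = digit-step y a s ps lo hi
    IH = digits-track y k (a + s * c) (s * ⅔) (pos-* (positive⁻¹ ⅔) ps) (proj₁ step) (proj₂ step)
    t = left-end (digits y (a + s * c) (s * ⅔) (pos-* (positive⁻¹ ⅔) ps)) k
    identity₁ : ∀ a s c t → a + s * (c + ⅔ * t) ≡ (a + s * c) + (s * ⅔) * t
    identity₁ = solve-∀ ℚ-ring
    identity₂ : ∀ a s c t p → a + s * ((c + ⅔ * t) + ⅔ * p) ≡ (a + s * c) + (s * ⅔) * (t + p)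
    identity₂ = solve-∀ ℚ-ring

  address-track : ∀ x → x ∈[0,1] → ∀ n →
    (fromℚ (left-end (address x) n) ≤ℝ x) × (x ≤ℝ fromℚ (left-end (address x) n + width n))
  address-track x (0≤x , x≤1) n =
    subst (λ z → fromℚ z ≤ℝ x) (identity₁ (left-end α n)) (proj₁ track) ,
    subst (λ z → x ≤ℝ fromℚ z) (identity₂ (left-end α n) (width n)) (proj₂ track)
    where
    α = address x
    track = digits-track x n 0ℚ 1ℚ (positive⁻¹ 1ℚ) 0≤x (subst (λ z → x ≤ℝ fromℚ z) (sym (+-identityˡ 1ℚ)) x≤1)
    identity₁ : ∀ t → 0ℚ + 1ℚ * t ≡ t
    identity₁ = solve-∀ ℚ-ring
    identity₂ : ∀ t p → 0ℚ + 1ℚ * (t + p) ≡ t + p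
    identity₂ = solve-∀ ℚ-ring

  module AtTolerance (ε : ℝ) (pε : 0ℝ <ℝ ε) where
    WorksOn : List Bool → ℚ → Set
    WorksOn u δ = ∀ δ' → pos δ' → δ' ≤ δ → ∀ y → y ∈[0,1] →
                  fromℚ (left u) ≤ℝ y → y ≤ℝ fromℚ (left u + width (length u)) → P y ε (fromℚ δ')

    works-antitone : ∀ u {δ δ'} → pos δ' → δ' ≤ δ → WorksOn u δ → WorksOn u δ'
    works-antitone u _ δ'≤δ works δ'' pδ'' δ''≤δ' = works δ'' pδ'' (≤-trans δ''≤δ' δ'≤δ)

    Good : List Bool → Set
    Good u = Σ ℚ λ δ → pos δ × WorksOn u δ

    -- Continuity at `point α` gives δ₀; once the width of I_{ᾱ(k)} is below
    -- δ₀/4, every y ∈ I_{ᾱ(k)} is within 3δ₀/4 of the point, and shifting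
    -- leaves a margin of δ₀/8.
    good-prefix : ∀ α → Σ ℕ λ k → Good (initial α k)
    good-prefix α = k , e * ½ , pos-*½ pe , works
      where
      x : ℝ
      x = point α
      at-x = pointwise x (point∈[0,1] α) ε pε
      δ₀ = proj₁ at-x
      pδ₀ = proj₁ (proj₂ at-x)
      e₀ = proj₁ pδ₀
      pe₀ = proj₁ (proj₂ pδ₀)
      e : ℚ
      e = e₀ * ¼
      pe : pos e
      pe = pos-*¼ pe₀
      k : ℕ
      k = proj₁ (width-small e pe)
      room = margin δ₀ e₀ pe₀ (proj₂ (proj₂ pδ₀))
      d : ℝ
      d = fromℚ (e + (e + e))
      works : WorksOn (initial α k) (e * ½)
      works δ' pδ' δ'≤ y y∈ lo hi =
        P-antitone y ε (δ₀ -ℝ d) (fromℚ δ') y∈ pε (proj₂ room 0ℚ (<⇒≤ (pos-*½ pe))) (fromℚ-pos pδ') (proj₂ room δ' δ'≤)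
          (shift x y ε δ₀ d (point∈[0,1] α) y∈ pε pδ₀ (proj₂ (proj₂ at-x))
            (interval-close α k y e pe (proj₂ (width-small e pe)) lo
              (subst (λ m → y ≤ℝ fromℚ (left-end α k + width m)) (length-initial α k) hi))
            (proj₁ room))

    -- A δ that works on an interval along every sequence works at every
    -- x ∈ [0,1], since x lies in the intervals along its address.
    works-everywhere : ∀ {N} δ → pos δ → PrefixWithin N (λ u → WorksOn u δ) → (x : ℝ) → x ∈[0,1] → P x ε (fromℚ δ)
    works-everywhere {N} δ pδ within x x∈ = at-prefix (within (address x))
      where
      at-prefix : (Σ ℕ λ n → n ℕ.≤ N × WorksOn (initial (address x) n) δ) → P x ε (fromℚ δ)
      at-prefix (n , _ , works) =
        works δ pδ ≤-refl x x∈ (proj₁ (address-track x x∈ n))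
          (subst (λ m → x ≤ℝ fromℚ (left-end (address x) n + width m)) (sym (length-initial (address x) n))
                 (proj₂ (address-track x x∈ n)))

    -- FT bounds the good prefixes, and the minimum of their δ's works everywhere.
    uniform : Σ ℝ λ δ → (0ℝ <ℝ δ) × ((x : ℝ) → x ∈[0,1] → P x ε δ)
    uniform = from-bound (uniform-within {Good} (ft Good (bar-from-initial {Good} good-prefix)))
      where
      from-min : ∀ {N} → (Σ ℚ λ δ → pos δ × PrefixWithin N (λ u → WorksOn u δ)) →
                 Σ ℝ λ δ → (0ℝ <ℝ δ) × ((x : ℝ) → x ∈[0,1] → P x ε δ)
      from-min (δ , pδ , within) = fromℚ δ , fromℚ-pos pδ , works-everywhere δ pδ within
      from-bound : (Σ ℕ λ N → PrefixWithin N Good) → Σ ℝ λ δ → (0ℝ <ℝ δ) × ((x : ℝ) → x ∈[0,1] → P x ε δ)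
      from-bound (N , within) = from-min (uniform-min N WorksOn works-antitone within)

  uniformly-continuous : UniformlyContinuousPredicate P
  uniformly-continuous = record { continuous = cp ; uniform = AtTolerance.uniform }

module UC⇒FT (uc : CPisUC) (B : List Bool → Set) (bar : IsBar B) where
  -- separated halves [0, 1/3] and [2/3, 1]
  open Intervals ⅔ ⅓ (nonNegative⁻¹ ⅔) (positive⁻¹ ⅓) (≤ᵇ⇒≤ _) refl

  P : ℝ → ℝ → ℝ → Set
  P x ε δ = ∀ α → ∣ point α -ℝ x ∣< δ → Σ ℕ λ n → B (initial α n) × (δ ≤ℝ fromℚ (width n))

  P-extensional : Extensional P
  P-extensional x x' ε ε' δ δ' x≃x' _ δ≃δ' Pxεδ α close =
    n , proj₁ (proj₂ at-x) , ≤ℝ-trans {δ'} {δ} {fromℚ (width n)} (proj₂ δ≃δ') (proj₂ (proj₂ at-x))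
    where
    at-x = Pxεδ α (∣∣<-resp (point α) x x' δ δ' x≃x' δ≃δ' close)
    n = proj₁ at-x

  -- Shift: points within δ - δ' of y are within δ of x, and δ - δ' ≤ δ.
  P-shift : ∀ x y ε δ δ' → x ∈[0,1] → y ∈[0,1] → 0ℝ <ℝ ε → 0ℝ <ℝ δ →
            P x ε δ → ∣ x -ℝ y ∣< δ' → δ' <ℝ δ → P y ε (δ -ℝ δ')
  P-shift x y ε δ δ' _ _ _ _ Pxεδ xy<δ' _ α αy< =
    n , proj₁ (proj₂ at-x) , sub-nonneg-≤ {δ} {δ'} {fromℚ (width n)} (proj₂ (proj₂ at-x)) (∣∣<-nonneg {x -ℝ y} {δ'} xy<δ')
    where
    at-x = Pxεδ α (∣∣<-triangle (point α) y x δ δ' αy< xy<δ')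
    n = proj₁ at-x

  Near : ℝ → ℚ → ℚ → (ℕ → Bool) → ℚ → Set
  Near x a s α D = Eventually₂ λ n j →
    ((a + s * left-end α n) - seq x j < D) × (- ((a + s * left-end α n) - seq x j) < D)

  -- A point D ≤ s/12 close to x ∈ [a, a + s] lies on the same side of the
  -- gap (a + s/3, a + 2s/3) as the approximation used by `digit`.
  first-digit : ∀ x a s ps α D → Near x a s α D → D ≤ s * ¹⁄₁₂ → α 0 ≡ digit x a s ps
  first-digit x a s ps α D (N , near) D≤ = by-digit (α 0) refl (isNo-spec (seq x M <? a + s * ½))
    where
    approx = cauchy₂ x (s * ¹⁄₁₂) (pos-* (positive⁻¹ ¹⁄₁₂) ps)
    M : ℕ
    M = proj₁ approx
    j : ℕ
    j = N ⊔ M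
    N≤j = ℕP.m≤m⊔n N M
    β = λ i → α (suc i)
    t = left-end β j
    near-j = near (suc j) j (ℕP.m≤n⇒m≤1+n N≤j) N≤j
    xj≈xM = proj₂ approx j M (ℕP.m≤n⊔m N M) ℕP.≤-refl
    0≤s = <⇒≤ ps
    -- the rest of the point lies in [0, s/3]
    st≤s/3 : s * (⅓ * t) ≤ s * ⅓
    st≤s/3 = *-monoˡ-≤-nonNeg s {{nonNegative 0≤s}} (subst (⅓ * t ≤_) (*-identityʳ ⅓) (*-monoˡ-≤-nonNeg ⅓ (left-end≤1 β j)))
    0≤st : 0ℚ ≤ s * (⅓ * t)
    0≤st = subst (_≤ s * (⅓ * t)) (*-zeroʳ s)
             (*-monoˡ-≤-nonNeg s {{nonNegative 0≤s}} (subst (_≤ ⅓ * t) (*-zeroʳ ⅓) (*-monoˡ-≤-nonNeg ⅓ (proj₁ (interval⊆[0,1] β j)))))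
    identity₀ : ∀ xM xj a s t D → xM ≡ (a + s * ½) + ((((- (xj - xM)) + (- ((a + s * (0ℚ + ⅓ * t)) - xj))) + (D + s * (⅓ * t))) - ((s * ¹⁄₁₂ + D) + (s * ¹⁄₁₂ + s * ⅓)))
    identity₀ = solve-∀ ℚ-ring
    below : α 0 ≡ false → seq x M < a + s * ½
    below α0≡0 = <-via (+-mono-<-≤ (+-mono-< (proj₂ xj≈xM) near-below) (+-mono-≤ D≤ st≤s/3)) (identity₀ (seq x M) (seq x j) a s t D)
      where
      near-below : - ((a + s * (0ℚ + ⅓ * t)) - seq x j) < D
      near-below = subst (λ b → - ((a + s * (offset b ⅔ + ⅓ * t)) - seq x j) < D) α0≡0 (proj₂ near-j)
    identity₁ : ∀ xM xj a s t D → a + s * ½ ≡ xM + ((((xj - xM) + ((a + s * (⅔ + ⅓ * t)) - xj)) + (D + 0ℚ)) - ((s * ¹⁄₁₂ + D) + (s * ¹⁄₁₂ + s * (⅓ * t))))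
    identity₁ = solve-∀ ℚ-ring
    above : α 0 ≡ true → a + s * ½ < seq x M
    above α0≡1 = <-via (+-mono-<-≤ (+-mono-< (proj₁ xj≈xM) near-above) (+-mono-≤ D≤ 0≤st)) (identity₁ (seq x M) (seq x j) a s t D)
      where
      near-above : (a + s * (⅔ + ⅓ * t)) - seq x j < D
      near-above = subst (λ b → (a + s * (offset b ⅔ + ⅓ * t)) - seq x j < D) α0≡1 (proj₁ near-j)
    by-digit : ∀ b → α 0 ≡ b →
      ((digit x a s ps ≡ false) × (seq x M < a + s * ½)) ⊎ ((digit x a s ps ≡ true) × ¬ (seq x M < a + s * ½)) →
      α 0 ≡ digit x a s ps
    by-digit false α0≡b (inj₁ (d≡b , _)) = trans α0≡b (sym d≡b)
    by-digit false α0≡b (inj₂ (_ , xM≮)) = ⊥-elim (xM≮ (below α0≡b))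
    by-digit true α0≡b (inj₁ (_ , xM<)) = ⊥-elim (<-asym xM< (above α0≡b))
    by-digit true α0≡b (inj₂ (d≡b , _)) = trans α0≡b (sym d≡b)

  shared-digits : ∀ x k a s ps α → Near x a s α ((s * ¹⁄₁₂) * width k) → initial α k ≡ initial (digits x a s ps) k
  shared-digits x zero a s ps α near = refl
  shared-digits x (suc k) a s ps α near = cong₂ _∷_ α0≡ (shared-digits x k a' s' ps' β near-tail)
    where
    D≤ : (s * ¹⁄₁₂) * width (suc k) ≤ s * ¹⁄₁₂
    D≤ = subst ((s * ¹⁄₁₂) * width (suc k) ≤_) (*-identityʳ (s * ¹⁄₁₂))
           (*-monoˡ-≤-nonNeg (s * ¹⁄₁₂) {{nonNegative (<⇒≤ (pos-* (positive⁻¹ ¹⁄₁₂) ps))}} (width≤1 (suc k)))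
    α0≡ = first-digit x a s ps α _ near D≤
    β = λ i → α (suc i)
    a' = a + s * offset (digit x a s ps) ⅔
    s' = s * ⅓
    ps' = pos-* (positive⁻¹ ⅓) ps
    identity₁ : ∀ a s c t → a + s * (c + ⅓ * t) ≡ (a + s * c) + (s * ⅓) * t
    identity₁ = solve-∀ ℚ-ring
    identity₂ : ∀ s p → (s * ¹⁄₁₂) * (⅓ * p) ≡ ((s * ⅓) * ¹⁄₁₂) * p
    identity₂ = solve-∀ ℚ-ring
    near-tail : Near x a' s' β ((s' * ¹⁄₁₂) * width k)
    near-tail = subst (λ b → Near x (a + s * offset b ⅔) s' β ((s' * ¹⁄₁₂) * width k)) α0≡
      (proj₁ near , λ n j Nn Nj →
        subst₂ (λ X D → (X - seq x j < D) × (- (X - seq x j) < D))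
               (identity₁ a s (offset (α 0) ⅔) (left-end β n)) (identity₂ s (width k))
               (proj₂ near (suc n) j (ℕP.m≤n⇒m≤1+n Nn) Nj))

  near-point : ∀ x α D → ∣ point α -ℝ x ∣< fromℚ D → Near x 0ℚ 1ℚ α D
  near-point x α D ((e₁ , pe₁ , above) , (e₂ , pe₂ , below)) =
    ev₂-map (λ n j p →
      <-via (+-mono-≤-< (proj₁ (proj₁ p)) (proj₁ (proj₂ (proj₁ p)))) (identity₁ (left-end α n) (seq x n) (seq x j) D e₁) ,
      <-via (+-mono-≤-< (proj₁ (proj₂ p)) (proj₂ (proj₂ (proj₂ p)))) (identity₂ (left-end α n) (seq x n) (seq x j) D e₂))
      (ev₂-both (ev₂-both (ev₂-first above) (cauchy₂ x e₁ pe₁)) (ev₂-both (ev₂-first below) (cauchy₂ x e₂ pe₂)))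
    where
    identity₁ : ∀ t xn xj D e → (0ℚ + 1ℚ * t) - xj ≡ D + ((((t - xn) + e) + (xn - xj)) - (D + e))
    identity₁ = solve-∀ ℚ-ring
    identity₂ : ∀ t xn xj D e → - ((0ℚ + 1ℚ * t) - xj) ≡ D + ((((- (t - xn)) + e) + (- (xn - xj))) - (D + e))
    identity₂ = solve-∀ ℚ-ring

  -- Continuity at x: with n₀ the bar length along the address of x, points
  -- within width n₀ / 12 of x share their first n₀ digits with x.
  P-pointwise : ∀ x ε → Σ ℝ λ δ → (0ℝ <ℝ δ) × P x ε δ
  P-pointwise x ε = fromℚ D , fromℚ-pos pD , at-x
    where
    n₀ : ℕ
    n₀ = proj₁ (initial-bar {B} bar (address x))
    D : ℚ
    D = (1ℚ * ¹⁄₁₂) * width n₀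
    pD : pos D
    pD = pos-* (width-pos n₀) (pos-* (positive⁻¹ ¹⁄₁₂) (positive⁻¹ 1ℚ))
    D≤w : D ≤ width n₀
    D≤w = ≤-trans (*-monoʳ-≤-nonNeg (width n₀) {{nonNegative (<⇒≤ (width-pos n₀))}} {1ℚ * ¹⁄₁₂} {1ℚ} (≤ᵇ⇒≤ _)) (≤-reflexive (*-identityˡ (width n₀)))
    at-x : P x ε (fromℚ D)
    at-x α close =
      n₀ , subst B (sym (shared-digits x n₀ 0ℚ 1ℚ (positive⁻¹ 1ℚ) α (near-point x α D close))) (proj₂ (initial-bar {B} bar (address x))) ,
      fromℚ-mono-≤ D≤w

  continuous : ContinuousPredicate P
  continuous = record { extensional = P-extensional ; pointwise = λ x _ ε _ → P-pointwise x ε ; shift = P-shift }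

  width-index-bound : ∀ {δ e n K} → Eventually (λ m → 0ℚ + e ≤ seq δ m) → δ ≤ℝ fromℚ (width n) → width K < e → n ℕ.≤ K
  width-index-bound {δ} {e} {n} {K} e≤δ δ≤w wK<e with n ℕ.≤? K
  ... | yes n≤K = n≤K
  ... | no n≰K = ⊥-elim (<-irrefl refl (<-via
        (+-mono-≤-< (+-mono-≤ (+-mono-≤ (proj₁ at-m) (proj₂ at-m)) (width-antitone (ℕP.<⇒≤ (ℕP.≰⇒> n≰K)))) (*-monoˡ-<-pos ½ wK<e))
        (identity e (seq δ m) (width n) (width K))))
    where
    identity : ∀ e d wn wK → e ≡ e + (((((0ℚ + e) + d) + wn) + wK * ½) - (((d + (wn + (e - wK) * ½)) + wK) + e * ½))
    identity = solve-∀ ℚ-ring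
    gap : pos ((e - width K) * ½)
    gap = pos-*½ (<-via {L = 0ℚ} {R = e - width K} wK<e (identity₀ (width K) e))
      where
      identity₀ : ∀ w e → 0ℚ ≡ (e - w) + (w - e)
      identity₀ = solve-∀ ℚ-ring
    both = ev-both e≤δ (≤ℝ-approx {δ} {fromℚ (width n)} δ≤w ((e - width K) * ½) gap)
    m : ℕ
    m = proj₁ both
    at-m = proj₂ both m ℕP.≤-refl

  -- A uniform δ for ε = 1, applied at each point α itself, bounds the bar.
  uniform-bar : IsUniform B
  uniform-bar = within-uniform {K} {B} bounded
    where
    at-1 = UniformlyContinuousPredicate.uniform (uc P continuous) 1ℝ (fromℚ-pos (positive⁻¹ 1ℚ))
    δ = proj₁ at-1
    pδ = proj₁ (proj₂ at-1)
    e = proj₁ pδ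
    pe = proj₁ (proj₂ pδ)
    K : ℕ
    K = proj₁ (width-small e pe)
    bounded : PrefixWithin K B
    bounded α = n , width-index-bound {δ} (proj₂ (proj₂ pδ)) (proj₂ (proj₂ at-α)) (proj₂ (width-small e pe)) , proj₁ (proj₂ at-α)
      where
      at-α = proj₂ (proj₂ at-1) (point α) (point∈[0,1] α) α (∣∣<-self (point α) {δ} pδ)
      n = proj₁ at-α

theorem16 : FanTheorem ⇔ CPisUC
theorem16 = mk⇔ FT⇒UC.uniformly-continuous UC⇒FT.uniform-bar
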